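{- Let $k \in \mathbb{N}$, let $m_1,m_2$ be integers with $1 \leq m_1 \leq m_2$, let $G = K_{1,m_1}+K_{1,m_2}$, and let $\rho = \lceil (m_1+m_2+2)/k \rceil$. If $m_2 > \rho(k-1) - 1 - \max\{0, m_1 - \rho + 1\}$, then $G$ is not equitably $k$-choosable.
   Context: All graphs are finite and simple. A list assignment $L$ for a graph $G$ assigns to each vertex $v$ a set $L(v)$ of colors; it is a $k$-assignment if $|L(v)|=k$ for all $v$. The palette of $L$ is $\bigcup_{v} L(v)$. A proper $L$-coloring is a proper coloring $f$ with $f(v)\in L(v)$ for all $v$. If $L$ is a $k$-assignment, an equitable $L$-coloring of $G$ is a proper $L$-coloring in which each color of the palette appears on at most $\lceil |V(G)|/k \rceil$ vertices. $G$ is equitably $k$-choosable if an equitable $L$-coloring exists for every $k$-assignment $L$ for $G$. -}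

module Defs where

open import Data.Nat using (ℕ; zero; suc; _+_; _∸_; _≤_; NonZero)
open import Data.Nat.DivMod using (_/_)
open import Data.Fin using (Fin; zero; splitAt)
open import Data.List using (List; length; filter)
open import Data.List.Membership.Propositional using (_∈_)
open import Data.List.Relation.Unary.Unique.Propositional using (Unique)
open import Data.Nat.Properties using (_≟_)
open import Data.List using (allFin)
open import Data.Product using (Σ; ∃; _×_; _,_)
open import Data.Sum using (_⊎_; inj₁; inj₂)
open import Data.Empty using (⊥)
open import Relation.Nullary using (¬_)
open import Relation.Binary.PropositionalEquality using (_≡_; _≢_)

⌈_/_⌉ : ℕ → (k : ℕ) → .{{NonZero k}} → ℕ
⌈ n / k ⌉ = (n + (k ∸ 1)) / k

record Graph (n : ℕ) : Set₁ where
  field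
    Adj     : Fin n → Fin n → Set
    sym     : ∀ {u v} → Adj u v → Adj v u
    irrefl  : ∀ {u} → ¬ Adj u u

starAdj : ∀ {m} → Fin (suc m) → Fin (suc m) → Set
starAdj i j = (i ≡ zero × j ≢ zero) ⊎ (j ≡ zero × i ≢ zero)

star : (m : ℕ) → Graph (suc m)
star m = record { Adj = starAdj ; sym = s ; irrefl = ir }
  where
  s : ∀ {u v} → starAdj u v → starAdj v u
  s (inj₁ p) = inj₂ p
  s (inj₂ p) = inj₁ p
  ir : ∀ {u} → ¬ starAdj u u
  ir (inj₁ (p , q)) = q p
  ir (inj₂ (p , q)) = q p

-- Disjoint union G + H on Fin (a + b): first a vertices are G, rest are H.
unionAdj : ∀ {a b} → Graph a → Graph b → Fin (a + b) → Fin (a + b) → Set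
unionAdj {a} G H u v with splitAt a u | splitAt a v
... | inj₁ x | inj₁ y = Graph.Adj G x y
... | inj₂ x | inj₂ y = Graph.Adj H x y
... | inj₁ _ | inj₂ _ = ⊥
... | inj₂ _ | inj₁ _ = ⊥

_⊕_ : ∀ {a b} → Graph a → Graph b → Graph (a + b)
_⊕_ {a} {b} G H = record { Adj = unionAdj G H ; sym = s ; irrefl = ir }
  where
  s : ∀ {u v} → unionAdj G H u v → unionAdj G H v u
  s {u} {v} p with splitAt a u | splitAt a v
  ... | inj₁ x | inj₁ y = Graph.sym G p
  ... | inj₂ x | inj₂ y = Graph.sym H p
  ir : ∀ {u} → ¬ unionAdj G H u u
  ir {u} p with splitAt a u
  ... | inj₁ x = Graph.irrefl G p
  ... | inj₂ x = Graph.irrefl H p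

record Assignment (n k : ℕ) : Set where
  field
    L      : Fin n → List ℕ
    unique : ∀ v → Unique (L v)
    size   : ∀ v → length (L v) ≡ k

InPalette : ∀ {n k} → Assignment n k → ℕ → Set
InPalette {n} A c = ∃ λ (v : Fin n) → c ∈ Assignment.L A v

count : ∀ {n} → (Fin n → ℕ) → ℕ → ℕ
count {n} f c = length (filter (λ v → f v ≟ c) (allFin n))

IsProperLColoring : ∀ {n k} → Graph n → Assignment n k → (Fin n → ℕ) → Set
IsProperLColoring G A f =
  (∀ v → f v ∈ Assignment.L A v) × (∀ u v → Graph.Adj G u v → f u ≢ f v)

IsEquitableLColoring : ∀ {n} k → .{{NonZero k}} → Graph n → Assignment n k → (Fin n → ℕ) → Set
IsEquitableLColoring {n} k G A f =
  IsProperLColoring G A f × (∀ c → InPalette A c → count f c ≤ ⌈ n / k ⌉)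

EquitablyChoosable : ∀ {n} → Graph n → (k : ℕ) → .{{NonZero k}} → Set
EquitablyChoosable {n} G k =
  (A : Assignment n k) → Σ (Fin n → ℕ) (IsEquitableLColoring k G A)

-- Give every vertex the list {0, …, k−1} and fix an equitable colouring f. Let c₀ be the colour of
-- the centre of the larger star K_{1,m₂}. In that star only the centre has colour c₀, and in the
-- smaller star c₀ is used on at most m₁ vertices, so c₀ colours at most min(ρ, m₁ + 1) vertices.
-- The remaining vertices share the other k − 1 colours, at most ρ each. Hence
-- m₁ + m₂ + 2 ≤ min(ρ, m₁ + 1) + ρ(k − 1), which is exactly the negation of the hypothesis.
module Submission where

open import Defs
open import Data.Nat using (ℕ; zero; suc; _+_; _*_; _∸_; _≤_; _<_; NonZero; z≤n; s≤s)
open import Data.Nat.Properties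
open import Data.Nat.ListAction using (sum)
open import Data.Fin using (Fin; zero; suc; _↑ˡ_; _↑ʳ_)
open import Data.Fin.Properties using (splitAt-↑ˡ; splitAt-↑ʳ)
open import Data.List using (List; []; _∷_; _++_; length; filter; map; tabulate; upTo)
open import Data.List.Properties
  using (length-++; length-tabulate; length-upTo; length-filter; filter-++; filter-accept;
         filter-reject; filter-none; filter-notAll)
open import Data.List.Membership.Propositional using (_∈_)
open import Data.List.Membership.Propositional.Properties using (∈-filter⁺)
open import Data.List.Relation.Unary.All as All using (All; []; _∷_)
open import Data.List.Relation.Unary.All.Properties using (tabulate⁺; filter⁺)
open import Data.List.Relation.Unary.Any as Any using (here; there)
open import Data.List.Relation.Unary.Unique.Propositional.Properties using (upTo⁺)
open import Data.Product using (_,_)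
open import Data.Sum using (inj₁)
open import Function using (_∘_; id)
open import Data.Bool using (true; false)
open import Relation.Nullary using (¬_; yes; no; ¬?; does)
open import Relation.Binary.PropositionalEquality
open import Algebra.Properties.CommutativeSemigroup +-commutativeSemigroup using (x∙yz≈y∙xz)

occurrences : ℕ → List ℕ → ℕ
occurrences c xs = length (filter (_≟ c) xs)

occurrences-++ : ∀ c xs ys → occurrences c (xs ++ ys) ≡ occurrences c xs + occurrences c ys
occurrences-++ c xs ys = trans (cong length (filter-++ (_≟ c) xs ys)) (length-++ (filter (_≟ c) xs))

occurrences-∷-self : ∀ x xs → occurrences x (x ∷ xs) ≡ suc (occurrences x xs)
occurrences-∷-self x xs = cong length (filter-accept (_≟ x) refl)

occurrences-∷-mono : ∀ c x xs → occurrences c xs ≤ occurrences c (x ∷ xs)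
occurrences-∷-mono c x xs with does (x ≟ c)
... | true = n≤1+n _
... | false = ≤-refl

sum-map-mono : ∀ {A : Set} {g h : A → ℕ} → (∀ x → g x ≤ h x) → ∀ xs → sum (map g xs) ≤ sum (map h xs)
sum-map-mono g≤h [] = z≤n
sum-map-mono g≤h (x ∷ xs) = +-mono-≤ (g≤h x) (sum-map-mono g≤h xs)

sum-map-≤ : ∀ {A : Set} {g : A → ℕ} {ρ} {xs} → All (λ x → g x ≤ ρ) xs → sum (map g xs) ≤ length xs * ρ
sum-map-≤ [] = z≤n
sum-map-≤ (gx≤ρ ∷ gxs≤ρ) = +-mono-≤ gx≤ρ (sum-map-≤ gxs≤ρ)

sum-occurrences-∷ : ∀ {x} xs cs → x ∈ cs →
  suc (sum (map (λ c → occurrences c xs) cs)) ≤ sum (map (λ c → occurrences c (x ∷ xs)) cs)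
sum-occurrences-∷ {x} xs (c ∷ cs) (here refl) =
  +-mono-≤ (≤-reflexive (sym (occurrences-∷-self x xs))) (sum-map-mono (λ c → occurrences-∷-mono c x xs) cs)
sum-occurrences-∷ {x} xs (c ∷ cs) (there x∈cs) =
  ≤-trans (≤-reflexive (sym (+-suc _ _))) (+-mono-≤ (occurrences-∷-mono c x xs) (sum-occurrences-∷ xs cs x∈cs))

length≤sum-occurrences : ∀ cs {xs} → All (_∈ cs) xs → length xs ≤ sum (map (λ c → occurrences c xs) cs)
length≤sum-occurrences cs [] = z≤n
length≤sum-occurrences cs {x ∷ xs} (x∈cs ∷ xs⊆cs) =
  ≤-trans (s≤s (length≤sum-occurrences cs xs⊆cs)) (sum-occurrences-∷ xs cs x∈cs)

tabulate-++ : ∀ {A : Set} a {b} (g : Fin (a + b) → A) →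
  tabulate g ≡ tabulate (g ∘ (_↑ˡ b)) ++ tabulate (g ∘ (a ↑ʳ_))
tabulate-++ zero g = refl
tabulate-++ (suc a) g = cong (g zero ∷_) (tabulate-++ a (g ∘ suc))

count≡occurrences : ∀ {n} (f : Fin n → ℕ) c → count f c ≡ occurrences c (tabulate f)
count≡occurrences {n} f c = along id
  where
  along : ∀ {m} (g : Fin m → Fin n) →
    length (filter (λ v → f v ≟ c) (tabulate g)) ≡ occurrences c (tabulate (f ∘ g))
  along {zero} g = refl
  along {suc m} g with does (f (g zero) ≟ c)
  ... | true = cong suc (along (g ∘ suc))
  ... | false = along (g ∘ suc)

count-⊕ : ∀ {a b} (f : Fin (a + b) → ℕ) c → count f c ≡ count (f ∘ (_↑ˡ b)) c + count (f ∘ (a ↑ʳ_)) c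
count-⊕ {a} {b} f c = begin
  count f c                                                       ≡⟨ count≡occurrences f c ⟩
  occurrences c (tabulate f)                                      ≡⟨ cong (occurrences c) (tabulate-++ a f) ⟩
  occurrences c (tabulate (f ∘ (_↑ˡ b)) ++ tabulate (f ∘ (a ↑ʳ_))) ≡⟨ occurrences-++ c (tabulate (f ∘ (_↑ˡ b))) (tabulate (f ∘ (a ↑ʳ_))) ⟩
  occurrences c (tabulate (f ∘ (_↑ˡ b))) + occurrences c (tabulate (f ∘ (a ↑ʳ_)))
    ≡⟨ sym (cong₂ _+_ (count≡occurrences (f ∘ (_↑ˡ b)) c) (count≡occurrences (f ∘ (a ↑ʳ_)) c)) ⟩
  count (f ∘ (_↑ˡ b)) c + count (f ∘ (a ↑ʳ_)) c                   ∎
  where open ≡-Reasoning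

size≤count+others : ∀ {n} (f : Fin n → ℕ) cs {ρ} → (∀ v → f v ∈ cs) → (∀ c → c ∈ cs → count f c ≤ ρ) →
  ∀ {c₀} → c₀ ∈ cs → n ≤ count f c₀ + (length cs ∸ 1) * ρ
size≤count+others {n} f cs {ρ} f∈cs class≤ρ {c₀} c₀∈cs = begin
  n                                                    ≡⟨ sym (length-tabulate f) ⟩
  length (tabulate f)                                  ≤⟨ length≤sum-occurrences (c₀ ∷ others) (tabulate⁺ (split ∘ f∈cs)) ⟩
  occurrences c₀ (tabulate f) + sum (map (λ c → occurrences c (tabulate f)) others)
    ≤⟨ +-mono-≤ (≤-reflexive (sym (count≡occurrences f c₀))) (sum-map-≤ classes≤ρ) ⟩
  count f c₀ + length others * ρ                       ≤⟨ +-monoʳ-≤ (count f c₀) (*-monoˡ-≤ ρ others≤) ⟩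
  count f c₀ + (length cs ∸ 1) * ρ                     ∎
  where
  open ≤-Reasoning
  others : List ℕ
  others = filter (λ c → ¬? (c ≟ c₀)) cs
  split : ∀ {c} → c ∈ cs → c ∈ c₀ ∷ others
  split {c} c∈cs with c ≟ c₀
  ... | yes refl = here refl
  ... | no c≢c₀ = there (∈-filter⁺ (λ c → ¬? (c ≟ c₀)) c∈cs c≢c₀)
  others≤ : length others ≤ length cs ∸ 1
  others≤ = <⇒≤pred (filter-notAll (λ c → ¬? (c ≟ c₀)) cs (Any.map (λ { refl c≢c → c≢c refl }) c₀∈cs))
  classes≤ρ : All (λ c → occurrences c (tabulate f) ≤ ρ) others
  classes≤ρ = filter⁺ (λ c → ¬? (c ≟ c₀))
    (All.tabulate λ {c} c∈cs → ≤-trans (≤-reflexive (sym (count≡occurrences f c))) (class≤ρ c c∈cs))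

IsProperColoring : ∀ {n} → Graph n → (Fin n → ℕ) → Set
IsProperColoring G f = ∀ u v → Graph.Adj G u v → f u ≢ f v

module _ {a b} (G : Graph a) (H : Graph b) {f : Fin (a + b) → ℕ} (proper : IsProperColoring (G ⊕ H) f) where

  proper-⊕ˡ : IsProperColoring G (f ∘ (_↑ˡ b))
  proper-⊕ˡ u v uv = proper (u ↑ˡ b) (v ↑ˡ b) adj
    where
    adj : Graph.Adj (G ⊕ H) (u ↑ˡ b) (v ↑ˡ b)
    adj rewrite splitAt-↑ˡ a u b | splitAt-↑ˡ a v b = uv

  proper-⊕ʳ : IsProperColoring H (f ∘ (a ↑ʳ_))
  proper-⊕ʳ u v uv = proper (a ↑ʳ u) (a ↑ʳ v) adj
    where
    adj : Graph.Adj (G ⊕ H) (a ↑ʳ u) (a ↑ʳ v)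
    adj rewrite splitAt-↑ʳ a b u | splitAt-↑ʳ a b v = uv

module _ {m} {g : Fin (suc m) → ℕ} (proper : IsProperColoring (star m) g) where

  star-leaf≢centre : ∀ j → g (suc j) ≢ g zero
  star-leaf≢centre j = ≢-sym (proper zero (suc j) (inj₁ (refl , λ ())))

  star-count-centre : count g (g zero) ≡ 1
  star-count-centre = begin
    count g (g zero)                                       ≡⟨ count≡occurrences g (g zero) ⟩
    occurrences (g zero) (g zero ∷ tabulate (g ∘ suc))     ≡⟨ occurrences-∷-self (g zero) _ ⟩
    suc (occurrences (g zero) (tabulate (g ∘ suc)))        ≡⟨ cong (suc ∘ length) (filter-none (_≟ g zero) (tabulate⁺ star-leaf≢centre)) ⟩
    1                                                      ∎
    where open ≡-Reasoning

  star-count≤ : 1 ≤ m → ∀ c → count g c ≤ m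
  star-count≤ 1≤m c with g zero ≟ c
  ... | yes refl = ≤-trans (≤-reflexive star-count-centre) 1≤m
  ... | no centre≢c = begin
    count g c                                   ≡⟨ count≡occurrences g c ⟩
    occurrences c (g zero ∷ tabulate (g ∘ suc)) ≡⟨ cong length (filter-reject (_≟ c) centre≢c) ⟩
    occurrences c (tabulate (g ∘ suc))          ≤⟨ length-filter (_≟ c) (tabulate (g ∘ suc)) ⟩
    length (tabulate (g ∘ suc))                 ≡⟨ length-tabulate (g ∘ suc) ⟩
    m                                           ∎
    where open ≤-Reasoning

star⊕star-count-centreʳ≤ : ∀ {a b} {f : Fin (suc a + suc b) → ℕ} → 1 ≤ a →
  IsProperColoring (star a ⊕ star b) f → count f (f (suc a ↑ʳ zero)) ≤ a + 1
star⊕star-count-centreʳ≤ {a} {b} {f} 1≤a proper = begin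
  count f (large zero)                              ≡⟨ count-⊕ {suc a} f (large zero) ⟩
  count small (large zero) + count large (large zero) ≡⟨ cong (count small (large zero) +_) (star-count-centre large-proper) ⟩
  count small (large zero) + 1                      ≤⟨ +-monoˡ-≤ 1 (star-count≤ small-proper 1≤a (large zero)) ⟩
  a + 1                                             ∎
  where
  open ≤-Reasoning
  small : Fin (suc a) → ℕ
  small = f ∘ (_↑ˡ suc b)
  large : Fin (suc b) → ℕ
  large = f ∘ (suc a ↑ʳ_)
  small-proper : IsProperColoring (star a) small
  small-proper = proper-⊕ˡ (star a) (star b) proper
  large-proper : IsProperColoring (star b) large
  large-proper = proper-⊕ʳ (star a) (star b) proper

m+[o∸n]≤o : ∀ {m n} o → m ≤ n → m ≤ o → m + (o ∸ n) ≤ o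
m+[o∸n]≤o {m} o m≤n m≤o = ≤-trans (+-monoʳ-≤ m (∸-monoʳ-≤ o m≤n)) (≤-reflexive (m+[n∸m]≡n m≤o))

listAssignment : ∀ n k → Assignment n k
listAssignment n k = record { L = λ _ → upTo k ; unique = λ _ → upTo⁺ k ; size = λ _ → length-upTo k }

lemma3p1 : (k m₁ m₂ : ℕ) → .{{_ : NonZero k}} → 1 ≤ m₁ → m₁ ≤ m₂ →
    ⌈ m₁ + m₂ + 2 / k ⌉ * (k ∸ 1) < m₂ + 1 + (m₁ + 1 ∸ ⌈ m₁ + m₂ + 2 / k ⌉) →
    ¬ EquitablyChoosable (star m₁ ⊕ star m₂) k
lemma3p1 k m₁ m₂ 1≤m₁ _ hyp choosable
  with choosable (listAssignment (suc m₁ + suc m₂) k)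
... | f , ((f∈upTo , proper) , equitable) = <-irrefl refl (begin-strict
  suc m₁ + suc m₂                  ≤⟨ size≤count+others f (upTo k) f∈upTo class≤ρ (f∈upTo centre) ⟩
  C + (length (upTo k) ∸ 1) * ρ    ≡⟨ cong (λ l → C + (l ∸ 1) * ρ) (length-upTo k) ⟩
  C + (k ∸ 1) * ρ                  ≡⟨ cong (C +_) (*-comm (k ∸ 1) ρ) ⟩
  C + ρ * (k ∸ 1)                  <⟨ +-monoʳ-< C hyp ⟩
  C + (m₂ + 1 + (m₁ + 1 ∸ ρ))      ≡⟨ x∙yz≈y∙xz C (m₂ + 1) (m₁ + 1 ∸ ρ) ⟩
  m₂ + 1 + (C + (m₁ + 1 ∸ ρ))      ≤⟨ +-monoʳ-≤ (m₂ + 1) (m+[o∸n]≤o (m₁ + 1) C≤ρ C≤m₁+1) ⟩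
  m₂ + 1 + (m₁ + 1)                ≡⟨ +-comm (m₂ + 1) (m₁ + 1) ⟩
  m₁ + 1 + (m₂ + 1)                ≡⟨ cong₂ _+_ (+-comm m₁ 1) (+-comm m₂ 1) ⟩
  suc m₁ + suc m₂                  ∎)
  where
  open ≤-Reasoning
  ρ = ⌈ m₁ + m₂ + 2 / k ⌉
  centre : Fin (suc m₁ + suc m₂)
  centre = suc m₁ ↑ʳ zero
  C = count f (f centre)
  size≡ : suc m₁ + suc m₂ ≡ m₁ + m₂ + 2
  size≡ = trans (cong suc (+-suc m₁ m₂)) (+-comm 2 (m₁ + m₂))
  class≤ρ : ∀ c → c ∈ upTo k → count f c ≤ ρ
  class≤ρ c c∈upTo = subst (λ n → count f c ≤ ⌈ n / k ⌉) size≡ (equitable c (centre , c∈upTo))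
  C≤ρ : C ≤ ρ
  C≤ρ = class≤ρ (f centre) (f∈upTo centre)
  C≤m₁+1 : C ≤ m₁ + 1
  C≤m₁+1 = star⊕star-count-centreʳ≤ 1≤m₁ proper
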